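{- Let $\mathcal{M}=(G,\mathcal{S})$ be a $k$-unicast instance which admits a moving cut $\ell$ of capacity strictly less than $\sum_{i\in[k]} d_i$ and distance $T$. Then any (network coding) protocol for $\mathcal{M}$ has makespan at least $T$.
   Context: A $k$-unicast instance $\mathcal{M}=(G,\mathcal{S})$: connected undirected graph $G=(V,E)$ with integer capacities $c_e\ge1$, sessions $\{(s_i,t_i,d_i)\}_{i=1}^k$ with $d_i\in\mathbb{Z}_{\ge1}$ sub-packets to be sent from $s_i$ to $t_i$. Protocols run in synchronous rounds; in each round each node sends on each incident edge $e$ a message of at most $c_e$ sub-packets that is an arbitrary predetermined function of what it received in earlier rounds and its own source packets. Makespan: number of rounds until every $t_i$ can determine $s_i$'s packet. A moving cut is an assignment $\ell:E\to\mathbb{Z}_{\ge1}$ of positive integer lengths to edges; it has capacity $C$ if $\sum_{e\in E} c_e(\ell_e-1)=C$, and distance $T$ if $d_\ell(s_i,t_j)\ge T$ for all $i,j\in[k]$, where $d_\ell$ is the shortest-path distance in $G$ with edge lengths $\ell$. -}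

module Defs where

open import Data.Nat using (ℕ; _+_; _*_; _∸_; _≤_; _<_)
open import Data.Fin using (Fin)
open import Data.Vec using (Vec)
open import Data.List using (List; map; allFin)
open import Data.Nat.ListAction using (sum)
open import Data.Product using (_×_; proj₁; proj₂)
open import Data.Bool using (Bool; true; false)
open import Relation.Binary.PropositionalEquality using (_≡_; _≢_)

-- A k-unicast instance: a finite simple connected undirected graph
-- (vertices Fin n, edges Fin m with endpoints and capacities c_e ≥ 1)
-- together with k sessions (s_i, t_i, d_i), d_i ≥ 1.
record UnicastInstance : Set where
  field
    n m   : ℕ
    ends  : Fin m → Fin n × Fin n
    cap   : Fin m → ℕ
    k     : ℕ
    src   : Fin k → Fin n
    dst   : Fin k → Fin n
    dem   : Fin k → ℕ

  tail : Fin m → Bool → Fin n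
  tail e true  = proj₁ (ends e)
  tail e false = proj₂ (ends e)

  head : Fin m → Bool → Fin n
  head e true  = proj₂ (ends e)
  head e false = proj₁ (ends e)

  data Walk : Fin n → Fin n → Set where
    []   : ∀ {u} → Walk u u
    step : ∀ {w} (e : Fin m) (b : Bool) → Walk (head e b) w → Walk (tail e b) w

  walkLen : (Fin m → ℕ) → ∀ {u v} → Walk u v → ℕ
  walkLen ℓ []           = 0
  walkLen ℓ (step e b w) = ℓ e + walkLen ℓ w

  Input : ℕ → Set
  Input q = (i : Fin k) → Vec (Fin q) (dem i)

  -- a transcript assigns to each round r, edge e and orientation b the
  -- message (c_e sub-packets) sent along e in that direction, as a function
  -- of the sources' packets
  Messages : ℕ → Set
  Messages q = ℕ → (e : Fin m) → (b : Bool) → Input q → Vec (Fin q) (cap e)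

  -- node v cannot distinguish x from x' before round r (rounds 0,1,..):
  -- same own source packets and same messages received in rounds r' < r
  SameView : ∀ {q} → Messages q → Fin n → ℕ → Input q → Input q → Set
  SameView msg v r x x' =
    ((i : Fin k) → src i ≡ v → x i ≡ x' i) ×
    ((r' : ℕ) → r' < r → (e : Fin m) (b : Bool) → head e b ≡ v →
       msg r' e b x ≡ msg r' e b x')

  -- protocol with R rounds: the message sent in round r on an edge is a
  -- (predetermined) function of the sender's view before round r
  IsProtocol : ∀ {q} → Messages q → ℕ → Set
  IsProtocol msg R = (r : ℕ) → r < R → (e : Fin m) (b : Bool) (x x' : Input _) →
    SameView msg (tail e b) r x x' → msg r e b x ≡ msg r e b x'

  Completes : ∀ {q} → Messages q → ℕ → Set
  Completes {q} msg R = (i : Fin k) (x x' : Input q) →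
    SameView msg (dst i) R x x' → x i ≡ x' i

  cutCapacity : (Fin m → ℕ) → ℕ
  cutCapacity ℓ = sum (map (λ e → cap e * (ℓ e ∸ 1)) (allFin m))

  totalDemand : ℕ
  totalDemand = sum (map dem (allFin k))

  CutDistance : (Fin m → ℕ) → ℕ → Set
  CutDistance ℓ T = (i j : Fin k) (w : Walk (src i) (dst j)) → T ≤ walkLen ℓ w

record WellFormed (I : UnicastInstance) : Set where
  open UnicastInstance I
  field
    capPos    : (e : Fin m) → 1 ≤ cap e
    demPos    : (i : Fin k) → 1 ≤ dem i
    noLoop    : (e : Fin m) → proj₁ (ends e) ≢ proj₂ (ends e)
    noParallel : (e e' : Fin m) (b : Bool) → tail e b ≡ tail e' true →
                 head e b ≡ head e' true → e ≡ e'
    connected : (u v : Fin n) → Walk u v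

-- Suppose R < T and let D be the ℓ-distance from the sources truncated at R + 1 (computed by
-- Bellman–Ford): D vanishes at the sources, D (head) ≤ D (tail) + ℓ e along every edge, and D
-- exceeds R at every sink. A node v at round r < D v can only know what crossed the moving cut,
-- i.e. the messages sent in a round r′ from a node with D ≤ r′ to one with D ≥ r′ + 2; by
-- induction on r, inputs agreeing on those messages look alike to such nodes, in particular to
-- the sinks after R rounds. So the input is determined by the crossing messages. Edge e carries
-- them in one direction only, during at most ℓ e − 1 rounds, hence in total at most
-- Σ c_e (ℓ_e − 1) < Σ d_i sub-packets, which is impossible over an alphabet of q ≥ 2 symbols.
module Submission where

open import Data.Bool using (Bool; true; false)
open import Data.Empty using (⊥-elim)
open import Data.Fin using (Fin; zero; suc; toℕ; fromℕ<; _≟_)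
open import Data.Fin.Properties using (injective⇒≤; toℕ-fromℕ<; any?)
open import Data.List using (List; []; _∷_; map; filter; allFin; tabulate; cartesianProduct)
open import Data.List.Extrema.Nat using (min; min≤⊤; min≤xs; argmin-sel)
open import Data.List.Membership.Propositional using (_∈_)
open import Data.List.Membership.Propositional.Properties
  using (∈-allFin; ∈-cartesianProduct⁺; ∈-map⁺; ∈-map⁻; ∈-filter⁺; ∈-filter⁻)
open import Data.List.Properties using (map-tabulate; tabulate-cong)
open import Data.List.Relation.Unary.All as All using ()
open import Data.List.Relation.Unary.Any using (here; there)
open import Data.Nat using (ℕ; zero; suc; _+_; _*_; _∸_; _^_; _≤_; _<_; z≤n; s≤s)
open import Data.Nat.Induction using (<-rec)
open import Data.Nat.ListAction using (sum)
open import Data.Nat.Properties hiding (_≟_)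
open import Data.Product using (Σ; ∃-syntax; _×_; _,_; proj₁; proj₂)
open import Data.Sum using (_⊎_; inj₁; inj₂)
open import Data.Vec as Vec using (Vec; _++_)
open import Data.Vec.Properties using (++-injective; take++drop≡id)
open import Data.Vec.Recursive using (Fin[m^n]↔Fin[m]^n)
open import Data.Vec.Recursive.Properties using (↔Vec)
open import Function using (_∘_; Injective; _↔_; _↣_; mk↣; Injection)
open import Function.Construct.Composition using (_↣-∘_; _↔-∘_)
open import Function.Properties.Inverse using (↔⇒↣; ↔-sym)
open import Relation.Binary.PropositionalEquality
open import Relation.Nullary using (Dec; yes; no; does)
open import Relation.Nullary.Decidable using (dec-true; dec-false)
open import Defs

module _ {A : Set} where

  flatten : ∀ {k} (d : Fin k → ℕ) → ((i : Fin k) → Vec A (d i)) → Vec A (sum (tabulate d))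
  flatten {zero}  d xs = Vec.[]
  flatten {suc k} d xs = xs zero ++ flatten (d ∘ suc) (xs ∘ suc)

  unflatten : ∀ {k} (d : Fin k → ℕ) → Vec A (sum (tabulate d)) → (i : Fin k) → Vec A (d i)
  unflatten {suc k} d v zero    = Vec.take (d zero) v
  unflatten {suc k} d v (suc i) = unflatten (d ∘ suc) (Vec.drop (d zero) v) i

  flatten-injective : ∀ {k} (d : Fin k → ℕ) (xs ys : (i : Fin k) → Vec A (d i)) →
                      flatten d xs ≡ flatten d ys → ∀ i → xs i ≡ ys i
  flatten-injective d xs ys eq zero    = proj₁ (++-injective (xs zero) (ys zero) eq)
  flatten-injective d xs ys eq (suc i) =
    flatten-injective (d ∘ suc) (xs ∘ suc) (ys ∘ suc) (proj₂ (++-injective (xs zero) (ys zero) eq)) i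

  flatten-cong : ∀ {k} (d : Fin k → ℕ) {xs ys : (i : Fin k) → Vec A (d i)} →
                 (∀ i → xs i ≡ ys i) → flatten d xs ≡ flatten d ys
  flatten-cong {zero}  d eq = refl
  flatten-cong {suc k} d eq = cong₂ _++_ (eq zero) (flatten-cong (d ∘ suc) (eq ∘ suc))

  flatten-unflatten : ∀ {k} (d : Fin k → ℕ) (v : Vec A (sum (tabulate d))) → flatten d (unflatten d v) ≡ v
  flatten-unflatten {zero}  d Vec.[] = refl
  flatten-unflatten {suc k} d v = begin
    Vec.take (d zero) v ++ flatten (d ∘ suc) (unflatten (d ∘ suc) (Vec.drop (d zero) v))
      ≡⟨ cong (Vec.take (d zero) v ++_) (flatten-unflatten (d ∘ suc) (Vec.drop (d zero) v)) ⟩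
    Vec.take (d zero) v ++ Vec.drop (d zero) v
      ≡⟨ take++drop≡id (d zero) v ⟩
    v ∎
    where open ≡-Reasoning

  unflatten-injective : ∀ {k} (d : Fin k → ℕ) (v w : Vec A (sum (tabulate d))) →
                        (∀ i → unflatten d v i ≡ unflatten d w i) → v ≡ w
  unflatten-injective d v w eq = begin
    v                          ≡⟨ flatten-unflatten d v ⟨
    flatten d (unflatten d v)  ≡⟨ flatten-cong d eq ⟩
    flatten d (unflatten d w)  ≡⟨ flatten-unflatten d w ⟩
    w                          ∎
    where open ≡-Reasoning

sum-tabulate-const : ∀ n c → sum (tabulate {n = n} λ _ → c) ≡ c * n
sum-tabulate-const zero    c = sym (*-zeroʳ c)
sum-tabulate-const (suc n) c = trans (cong (c +_) (sum-tabulate-const n c)) (sym (*-suc c n))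

Fin^↔Vec : ∀ q n → Fin (q ^ n) ↔ Vec (Fin q) n
Fin^↔Vec q n = ↔Vec n ↔-∘ Fin[m^n]↔Fin[m]^n q n

vec-injective⇒≤ : ∀ {q a b} → 2 ≤ q → {f : Vec (Fin q) a → Vec (Fin q) b} → Injective _≡_ _≡_ f → a ≤ b
vec-injective⇒≤ {q} {a} {b} 2≤q f-inj = ≮⇒≥ λ b<a → <⇒≱ (^-monoʳ-< q 2≤q b<a) (injective⇒≤ (Injection.injective code))
  where
    code : Fin (q ^ a) ↣ Fin (q ^ b)
    code = ↔⇒↣ (↔-sym (Fin^↔Vec q b)) ↣-∘ (mk↣ f-inj ↣-∘ ↔⇒↣ (Fin^↔Vec q a))

window-bound : ∀ {a r h L} → a ≤ r → 2 + r ≤ h → h ≤ a + L → r ∸ a < L ∸ 1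
window-bound {a} {r} {h} {L} a≤r 2+r≤h h≤a+L = ∸-monoˡ-≤ 1 (begin
  2 + (r ∸ a)  ≡⟨ +-∸-assoc 2 a≤r ⟨
  2 + r ∸ a    ≤⟨ ∸-monoˡ-≤ a (≤-trans 2+r≤h h≤a+L) ⟩
  a + L ∸ a    ≡⟨ m+n∸m≡n a L ⟩
  L            ∎)
  where open ≤-Reasoning

module _ (I : UnicastInstance) where
  open UnicastInstance I

  snoc : ∀ {u} e b → Walk u (tail e b) → Walk u (head e b)
  snoc e b []             = step e b []
  snoc e b (step e′ b′ w) = step e′ b′ (snoc e b w)

  walkLen-snoc : ∀ ℓ {u} e b (w : Walk u (tail e b)) → walkLen ℓ (snoc e b w) ≡ walkLen ℓ w + ℓ e
  walkLen-snoc ℓ e b []             = +-identityʳ (ℓ e)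
  walkLen-snoc ℓ e b (step e′ b′ w) = trans (cong (ℓ e′ +_) (walkLen-snoc ℓ e b w)) (sym (+-assoc (ℓ e′) _ _))

  Arc : Set
  Arc = Fin m × Bool

  arcs : List Arc
  arcs = cartesianProduct (allFin m) (true ∷ false ∷ [])

  ∈-arcs : ∀ e b → (e , b) ∈ arcs
  ∈-arcs e true  = ∈-cartesianProduct⁺ (∈-allFin e) (here refl)
  ∈-arcs e false = ∈-cartesianProduct⁺ (∈-allFin e) (there (here refl))

  Enters : Fin n → Arc → Set
  Enters v (e , b) = head e b ≡ v

  enters? : ∀ v (a : Arc) → Dec (Enters v a)
  enters? v (e , b) = head e b ≟ v

  blockSize : (Fin m → ℕ) → Fin m → ℕ
  blockSize ℓ e = sum (tabulate {n = ℓ e ∸ 1} λ _ → cap e)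

  sum-blockSize : ∀ ℓ → sum (tabulate (blockSize ℓ)) ≡ cutCapacity ℓ
  sum-blockSize ℓ = cong sum (trans (tabulate-cong λ e → sum-tabulate-const (ℓ e ∸ 1) (cap e))
                                    (sym (map-tabulate (λ e → e) λ e → cap e * (ℓ e ∸ 1))))

  sum-demand : sum (tabulate dem) ≡ totalDemand
  sum-demand = cong sum (sym (map-tabulate (λ i → i) dem))

  module TruncatedDistance (ℓ : Fin m → ℕ) (ℓ-pos : ∀ e → 1 ≤ ℓ e) (K : ℕ) where

    arcWeight : (Fin n → ℕ) → Arc → ℕ
    arcWeight P (e , b) = P (tail e b) + ℓ e

    entering : Fin n → List Arc
    entering v = filter (enters? v) arcs

    relax : (Fin n → ℕ) → Fin n → ℕ
    relax P v = min (P v) (map (arcWeight P) (entering v))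

    relax-≤ : ∀ P v → relax P v ≤ P v
    relax-≤ P v = min≤⊤ (P v) (map (arcWeight P) (entering v))

    relax-≤-arc : ∀ P e b → relax P (head e b) ≤ P (tail e b) + ℓ e
    relax-≤-arc P e b = All.lookup (min≤xs (P (head e b)) (map (arcWeight P) (entering (head e b))))
      (∈-map⁺ (arcWeight P) (∈-filter⁺ (enters? (head e b)) (∈-arcs e b) refl))

    relax-sel : ∀ P v → relax P v ≡ P v ⊎ ∃[ e ] ∃[ b ] head e b ≡ v × relax P v ≡ P (tail e b) + ℓ e
    relax-sel P v with argmin-sel (λ x → x) (P v) (map (arcWeight P) (entering v))
    ... | inj₁ eq = inj₁ eq
    ... | inj₂ ∈weights with ∈-map⁻ (arcWeight P) ∈weights
    ...   | (e , b) , ∈entering , eq = inj₂ (e , b , proj₂ (∈-filter⁻ (enters? v) {xs = arcs} ∈entering) , eq)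

    initial : Fin n → ℕ
    initial v with any? (λ i → src i ≟ v)
    ... | yes _ = 0
    ... | no  _ = K

    initial-≤ : ∀ v → initial v ≤ K
    initial-≤ v with any? (λ i → src i ≟ v)
    ... | yes _ = z≤n
    ... | no  _ = ≤-refl

    initial-src : ∀ i → initial (src i) ≡ 0
    initial-src i with any? (λ j → src j ≟ src i)
    ... | yes _     = refl
    ... | no  no-src = ⊥-elim (no-src (i , refl))

    initial-<⇒src : ∀ v → initial v < K → ∃[ i ] src i ≡ v
    initial-<⇒src v with any? (λ i → src i ≟ v)
    ... | yes is-src = λ _ → is-src
    ... | no  _      = λ K<K → ⊥-elim (<-irrefl refl K<K)

    estimate : ℕ → Fin n → ℕ
    estimate zero    = initial
    estimate (suc t) = relax (estimate t)

    estimate-≤ : ∀ t v → estimate t v ≤ K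
    estimate-≤ zero    v = initial-≤ v
    estimate-≤ (suc t) v = ≤-trans (relax-≤ (estimate t) v) (estimate-≤ t v)

    estimate-src : ∀ t i → estimate t (src i) ≡ 0
    estimate-src zero    i = initial-src i
    estimate-src (suc t) i = n≤0⇒n≡0 (subst (relax (estimate t) (src i) ≤_) (estimate-src t i) (relax-≤ (estimate t) (src i)))

    Within : ℕ → Fin n → Set
    Within x v = ∃[ i ] Σ (Walk (src i) v) λ w → walkLen ℓ w ≤ x

    within-snoc : ∀ {x} e b → Within x (tail e b) → Within (x + ℓ e) (head e b)
    within-snoc e b (i , w , w≤x) = i , snoc e b w , ≤-trans (≤-reflexive (walkLen-snoc ℓ e b w)) (+-monoˡ-≤ (ℓ e) w≤x)

    estimate-within : ∀ t v → estimate t v < K → Within (estimate t v) v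
    estimate-within zero v <K with initial-<⇒src v <K
    ... | i , refl = i , [] , z≤n
    estimate-within (suc t) v <K with relax-sel (estimate t) v
    ... | inj₁ eq = subst (λ x → Within x v) (sym eq) (estimate-within t v (subst (_< K) eq <K))
    ... | inj₂ (e , b , refl , eq) = subst (λ x → Within x (head e b)) (sym eq)
          (within-snoc e b (estimate-within t (tail e b) (≤-<-trans (m≤m+n _ (ℓ e)) (subst (_< K) eq <K))))

    -- A drop at step t + 1 is inherited from a drop at step t at the tail of the minimising arc,
    -- and each such step adds ℓ e ≥ 1.
    estimate-drop : ∀ t v → estimate (suc t) v < estimate t v → suc t ≤ estimate (suc t) v
    estimate-drop t v drop with relax-sel (estimate t) v
    ... | inj₁ eq = ⊥-elim (<-irrefl eq drop)
    estimate-drop zero v drop | inj₂ (e , b , refl , eq) = begin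
      1                           ≤⟨ ℓ-pos e ⟩
      ℓ e                         ≤⟨ m≤n+m (ℓ e) _ ⟩
      initial (tail e b) + ℓ e    ≡⟨ eq ⟨
      estimate 1 (head e b)       ∎
      where open ≤-Reasoning
    estimate-drop (suc t) v drop | inj₂ (e , b , refl , eq) = begin
      suc (suc t)                     ≡⟨ +-comm 1 (suc t) ⟩
      suc t + 1                       ≤⟨ +-mono-≤ (estimate-drop t (tail e b) tail-drop) (ℓ-pos e) ⟩
      estimate (suc t) (tail e b) + ℓ e ≡⟨ eq ⟨
      estimate (2 + t) (head e b)     ∎
      where
        open ≤-Reasoning
        tail-drop : estimate (suc t) (tail e b) < estimate t (tail e b)
        tail-drop = +-cancelʳ-< (ℓ e) _ _ (begin-strict
          estimate (suc t) (tail e b) + ℓ e  ≡⟨ eq ⟨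
          estimate (2 + t) (head e b)        <⟨ drop ⟩
          estimate (suc t) (head e b)        ≤⟨ relax-≤-arc (estimate t) e b ⟩
          estimate t (tail e b) + ℓ e        ∎)

    truncDist : Fin n → ℕ
    truncDist = estimate K

    estimate-stable : ∀ v → estimate (suc K) v ≡ truncDist v
    estimate-stable v with m≤n⇒m<n∨m≡n (relax-≤ (estimate K) v)
    ... | inj₂ eq   = eq
    ... | inj₁ drop = ⊥-elim (1+n≰n (≤-trans (estimate-drop K v drop) (estimate-≤ (suc K) v)))

    truncDist-src : ∀ i → truncDist (src i) ≡ 0
    truncDist-src = estimate-src K

    truncDist-lipschitz : ∀ e b → truncDist (head e b) ≤ truncDist (tail e b) + ℓ e
    truncDist-lipschitz e b = subst (_≤ truncDist (tail e b) + ℓ e) (estimate-stable (head e b)) (relax-≤-arc (estimate K) e b)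

    truncDist-within : ∀ v → truncDist v < K → Within (truncDist v) v
    truncDist-within = estimate-within K

  module MovingCut {q} (msg : Messages q) (D : Fin n → ℕ) where

    CutAgree : Input q → Input q → Set
    CutAgree x x′ = ∀ r e b → D (tail e b) ≤ r → 2 + r ≤ D (head e b) → msg r e b x ≡ msg r e b x′

    module _ {R} (prot : IsProtocol msg R) (D-src : ∀ i → D (src i) ≡ 0) {x x′ : Input q}
             (agree : CutAgree x x′) where

      sameView-beyondCut : ∀ r → r ≤ R → ∀ v → r < D v → SameView msg v r x x′
      sameView-beyondCut = <-rec (λ r → r ≤ R → ∀ v → r < D v → SameView msg v r x x′) induction-step
        where
          induction-step : ∀ r → (∀ {r′} → r′ < r → r′ ≤ R → ∀ v → r′ < D v → SameView msg v r′ x x′) →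
                           r ≤ R → ∀ v → r < D v → SameView msg v r x x′
          induction-step r earlier r≤R v r<D = own-packets , received
            where
              own-packets : ∀ i → src i ≡ v → x i ≡ x′ i
              own-packets i refl = ⊥-elim (n≮0 (subst (r <_) (D-src i) r<D))
              received : ∀ r′ → r′ < r → ∀ e b → head e b ≡ v → msg r′ e b x ≡ msg r′ e b x′
              received r′ r′<r e b refl with D (tail e b) ≤? r′
              ... | yes inside = agree r′ e b inside (≤-trans (s≤s r′<r) r<D)
              ... | no  outside = prot r′ (<-≤-trans r′<r r≤R) e b x x′
                    (earlier r′<r (≤-trans (<⇒≤ r′<r) r≤R) (tail e b) (≰⇒> outside))

    module _ (ℓ : Fin m → ℕ) (D-lipschitz : ∀ e b → D (head e b) ≤ D (tail e b) + ℓ e) where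

      forward : Fin m → Bool
      forward e = does (D (tail e true) ≤? D (head e true))

      forward-unique : ∀ e b → D (tail e b) < D (head e b) → forward e ≡ b
      forward-unique e true  up = dec-true  (D (tail e true) ≤? D (head e true)) (<⇒≤ up)
      forward-unique e false up = dec-false (D (tail e true) ≤? D (head e true)) (<⇒≱ up)

      crossing : (e : Fin m) → Fin (ℓ e ∸ 1) → Input q → Vec (Fin q) (cap e)
      crossing e j = msg (D (tail e (forward e)) + toℕ j) e (forward e)

      cutRecord : Input q → Vec (Fin q) (sum (tabulate (blockSize ℓ)))
      cutRecord x = flatten (blockSize ℓ) λ e → flatten (λ _ → cap e) λ j → crossing e j x

      cutRecord-agree : ∀ {x x′} → cutRecord x ≡ cutRecord x′ → CutAgree x x′
      cutRecord-agree {x} {x′} eq r e b tail≤r 2+r≤head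
        with forward-unique e b (≤-<-trans tail≤r (≤-trans (n≤1+n (suc r)) 2+r≤head))
      ... | refl = subst (λ r → msg r e b x ≡ msg r e b x′) round same
        where
          j : Fin (ℓ e ∸ 1)
          j = fromℕ< (window-bound tail≤r 2+r≤head (D-lipschitz e b))
          round : D (tail e b) + toℕ j ≡ r
          round = trans (cong (D (tail e b) +_) (toℕ-fromℕ< _)) (m+[n∸m]≡n tail≤r)
          same : crossing e j x ≡ crossing e j x′
          same = flatten-injective _ _ _ (flatten-injective (blockSize ℓ) _ _ eq e) j

  demand≤cutCapacity : ∀ {q} → 2 ≤ q → (ℓ : Fin m → ℕ) → (∀ e → 1 ≤ ℓ e) → ∀ R (msg : Messages q) →
                       CutDistance ℓ (suc R) → IsProtocol msg R → Completes msg R → totalDemand ≤ cutCapacity ℓ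
  demand≤cutCapacity 2≤q ℓ ℓ-pos R msg far prot done =
    subst₂ _≤_ sum-demand (sum-blockSize ℓ) (vec-injective⇒≤ 2≤q record-injective)
    where
      open TruncatedDistance ℓ ℓ-pos (suc R)
      open MovingCut msg truncDist

      dst-beyond : ∀ i → R < truncDist (dst i)
      dst-beyond i with truncDist (dst i) ≤? R
      ... | no  D≰R = ≰⇒> D≰R
      ... | yes D≤R with truncDist-within (dst i) (s≤s D≤R)
      ...   | j , w , w≤D = ⊥-elim (<⇒≱ (far j i w) (≤-trans w≤D D≤R))

      record-injective : Injective _≡_ _≡_ (cutRecord ℓ truncDist-lipschitz ∘ unflatten dem)
      record-injective {v} {w} eq = unflatten-injective dem v w λ i → done i _ _
        (sameView-beyondCut prot truncDist-src (cutRecord-agree ℓ truncDist-lipschitz eq) R ≤-refl (dst i) (dst-beyond i))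

lemma1p7 : (I : UnicastInstance) → WellFormed I →
    let open UnicastInstance I in
      (q : ℕ) → 2 ≤ q →
      (ℓ : Fin m → ℕ) → ((e : Fin m) → 1 ≤ ℓ e) → (T : ℕ) →
      cutCapacity ℓ < totalDemand → CutDistance ℓ T →
      (R : ℕ) (msg : Messages q) → IsProtocol msg R → Completes msg R →
      T ≤ R
lemma1p7 I _ q 2≤q ℓ ℓ-pos T capacity<demand far R msg prot done = ≮⇒≥ λ R<T →
  <⇒≱ capacity<demand (demand≤cutCapacity I 2≤q ℓ ℓ-pos R msg (λ i j w → ≤-trans R<T (far i j w)) prot done)
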